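{- Let $M$ be a macro scheme of size $b$ for a string $T$. Then $T$ has a string attractor of size at most $2b$.
   Context: A string attractor of a string $T$ of length $n$ is a set $\Gamma\subseteq\{1,\dots,n\}$ such that every substring $T[i..j]$ has an occurrence $T[i'..j']=T[i..j]$ with $p\in[i',j']$ for some $p\in\Gamma$. A macro scheme of size $b$ for $T$ is a set of $b$ directives, each either of the form $T[i..j]\leftarrow T[i'..j']$ (copy $T[i'..j']$ into $T[i..j]$) or $T[i]\leftarrow c$ with $c$ a character (assign $c$ to $T[i]$), such that $T$ can be unambiguously decoded from the directives: every position $p$ of $T$ is resolved by a finite chain of copies $T[p_1]\leftarrow T[p_2]\leftarrow\cdots\leftarrow T[p_{k}]\leftarrow c$ (with $p_1=p$) induced by the directives and ending in an assignment directive. -}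

module Defs where

open import Data.Nat using (ℕ; _+_; _∸_; _≤_; _<_)
open import Data.List using (List; []; _∷_; take; drop; length; lookup)
open import Data.List.Membership.Propositional using (_∈_)
open import Data.List.Relation.Unary.Unique.Propositional using (Unique)
open import Data.Fin using (Fin)
open import Data.Product using (Σ; ∃; ∃-syntax; _×_)
open import Relation.Binary.PropositionalEquality using (_≡_)

-- Conventions: a string T is a List A; positions are 0-indexed natural
-- numbers 0 .. length T - 1 (the paper's position p is our p - 1).

substr : {A : Set} → List A → ℕ → ℕ → List A
substr T i len = take len (drop i T)

InWindow : ℕ → ℕ → ℕ → Set
InWindow p i len = (i ≤ p) × (p < i + len)

IsAttractor : {A : Set} → List A → List ℕ → Set
IsAttractor T Γ =
  (∀ {p} → p ∈ Γ → p < length T) ×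
  (∀ i len → 1 ≤ len → i + len ≤ length T →
     ∃[ i' ] ((i' + len ≤ length T) ×
              (substr T i' len ≡ substr T i len) ×
              (∃[ p ] ((p ∈ Γ) × (InWindow p i' len)))))

-- copy i i' len  :  T[i .. i+len-1] ← T[i' .. i'+len-1]
-- assign i c     :  T[i] ← c
data Directive (A : Set) : Set where
  copy   : (i i' len : ℕ) → Directive A
  assign : (i : ℕ) (c : A) → Directive A

Covers : {A : Set} → Directive A → ℕ → Set
Covers (copy i i' len) p = InWindow p i len
Covers (assign i c)    p = p ≡ i

ValidFor : {A : Set} → List A → Directive A → Set
ValidFor T (copy i i' len) =
  (1 ≤ len) × (i + len ≤ length T) × (i' + len ≤ length T) ×
  (substr T i len ≡ substr T i' len)
ValidFor T (assign i c) =
  (i < length T) × (substr T i 1 ≡ c ∷ [])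

CopiesFrom : {A : Set} → List (Directive A) → ℕ → ℕ → Set
CopiesFrom D p q =
  ∃[ i ] ∃[ i' ] ∃[ len ]
    ((copy i i' len ∈ D) × (InWindow p i len) × (q ≡ i' + (p ∸ i)))

Assigned : {A : Set} → List (Directive A) → ℕ → Set
Assigned D p = ∃[ c ] (assign p c ∈ D)

data Resolved {A : Set} (D : List (Directive A)) : ℕ → Set where
  done : ∀ {p} → Assigned D p → Resolved D p
  step : ∀ {p q} → CopiesFrom D p q → Resolved D q → Resolved D p

IsMacroScheme : {A : Set} → List A → List (Directive A) → Set
IsMacroScheme T D =
  (∀ {d} → d ∈ D → ValidFor T d) ×
  (∀ p → p < length T →
     ∃[ k ] (Covers (lookup D k) p ×
             (∀ (k' : Fin (length D)) → Covers (lookup D k') p → k' ≡ k))) ×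
  (∀ p → p < length T → Resolved D p)

-- Take Γ to be the last positions of the targets of the directives. Consider a substring
-- T[a..a+L-1] and the copy directive whose target contains a. Either the substring reaches
-- the end of that target, so it already contains a position of Γ, or it lies inside the
-- target and is therefore equal to the substring starting at the source of a. Following the
-- copy chain of a, which ends at an assigned position (itself in Γ), yields an occurrence
-- containing a position of Γ. So even b positions suffice.
module Submission where

open import Defs
open import Data.Nat using (ℕ; _*_; _≤_; _<_; _+_; _∸_; _⊓_; pred; suc; s≤s)
open import Data.Nat.Properties
open import Data.List using (List; length; map; take; drop; deduplicate)
open import Data.List.Properties using (take-take; take-drop; drop-drop; length-deduplicate; length-map)
open import Data.List.Membership.Propositional using (_∈_)
open import Data.List.Membership.Propositional.Properties
  using (∈-map⁺; ∈-map⁻; ∈-deduplicate⁺; ∈-deduplicate⁻)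
open import Data.List.Relation.Unary.Unique.Propositional using (Unique)
open import Data.List.Relation.Unary.Unique.DecPropositional.Properties using (deduplicate-!)
open import Data.Product using (∃-syntax; _×_; _,_; proj₂)
open import Relation.Binary.PropositionalEquality
open import Relation.Nullary using (yes; no)
open import Function using (_∘_)

lastTargetPos : {A : Set} → Directive A → ℕ
lastTargetPos (copy i i' len) = pred (i + len)
lastTargetPos (assign i c)    = i

pred-inWindow : ∀ {a n L} → a < n → n ≤ a + L → InWindow (pred n) a L
pred-inWindow {n = suc n} (s≤s a≤n) n<a+L = a≤n , n<a+L

lastTargetPos<length : {A : Set} {T : List A} (d : Directive A) →
  ValidFor T d → lastTargetPos d < length T
lastTargetPos<length {T = T} (copy i i' len) (1≤len , i+len≤T , _) =
  <-≤-trans (proj₂ (pred-inWindow {L = len} (m<m+n i 1≤len) ≤-refl)) i+len≤T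
lastTargetPos<length (assign i c) (i<T , _) = i<T

substr-substr : {A : Set} (T : List A) (i len d L : ℕ) → d + L ≤ len →
  substr (substr T i len) d L ≡ substr T (i + d) L
substr-substr T i len d L d+L≤len = begin
  take L (drop d (take len (drop i T)))       ≡⟨ take-drop L d _ ⟩
  drop d (take (d + L) (take len (drop i T)))  ≡⟨ cong (drop d) (take-take (d + L) len _) ⟩
  drop d (take ((d + L) ⊓ len) (drop i T))     ≡⟨ cong (λ k → drop d (take k (drop i T))) (m≤n⇒m⊓n≡m d+L≤len) ⟩
  drop d (take (d + L) (drop i T))             ≡⟨ take-drop L d _ ⟨
  take L (drop d (drop i T))                   ≡⟨ cong (take L) (drop-drop i d T) ⟩
  take L (drop (i + d) T)                      ∎
  where open ≡-Reasoning

offset-inside : ∀ {i a L len} → i ≤ a → a + L ≤ i + len → (a ∸ i) + L ≤ len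
offset-inside {i} {a} {L} {len} i≤a a+L≤ = +-cancelˡ-≤ i _ _ (begin
  i + ((a ∸ i) + L)  ≡⟨ +-assoc i (a ∸ i) L ⟨
  i + (a ∸ i) + L    ≡⟨ cong (_+ L) (m+[n∸m]≡n i≤a) ⟩
  a + L              ≤⟨ a+L≤ ⟩
  i + len            ∎)
  where open ≤-Reasoning

substr-copied : {A : Set} (T : List A) {i i' len a L : ℕ} →
  substr T i len ≡ substr T i' len → i ≤ a → a + L ≤ i + len →
  substr T a L ≡ substr T (i' + (a ∸ i)) L
substr-copied T {i} {i'} {len} {a} {L} same i≤a a+L≤ = begin
  substr T a L                         ≡⟨ cong (λ k → substr T k L) (m+[n∸m]≡n i≤a) ⟨
  substr T (i + d) L                   ≡⟨ substr-substr T i len d L d+L≤len ⟨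
  substr (substr T i len) d L          ≡⟨ cong (λ s → substr s d L) same ⟩
  substr (substr T i' len) d L         ≡⟨ substr-substr T i' len d L d+L≤len ⟩
  substr T (i' + d) L                  ∎
  where
    open ≡-Reasoning
    d = a ∸ i
    d+L≤len : d + L ≤ len
    d+L≤len = offset-inside i≤a a+L≤

Attracted : {A : Set} → List A → List ℕ → ℕ → ℕ → Set
Attracted T Γ a L =
  ∃[ a' ] ((a' + L ≤ length T) × (substr T a' L ≡ substr T a L) ×
           (∃[ p ] ((p ∈ Γ) × (InWindow p a' L))))

Attracted-resp : {A : Set} {T : List A} {Γ : List ℕ} {a q L : ℕ} →
  substr T q L ≡ substr T a L → Attracted T Γ q L → Attracted T Γ a L
Attracted-resp q≡a (a' , a'+L≤ , a'≡q , hit) = a' , a'+L≤ , trans a'≡q q≡a , hit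

module _ {A : Set} {T : List A} {D : List (Directive A)}
         (valid : ∀ {d} → d ∈ D → ValidFor T d)
         {Γ : List ℕ} (ends∈Γ : ∀ {d} → d ∈ D → lastTargetPos d ∈ Γ) where

  resolved⇒attracted : ∀ {a} L → Resolved D a → 1 ≤ L → a + L ≤ length T → Attracted T Γ a L
  resolved⇒attracted {a} L (done (_ , a∈D)) 1≤L a+L≤T =
    a , a+L≤T , refl , a , ends∈Γ a∈D , ≤-refl , m<m+n a 1≤L
  resolved⇒attracted {a} L (step (i , i' , len , cp∈D , (i≤a , a<i+len) , refl) r) 1≤L a+L≤T
    with valid cp∈D | i + len ≤? a + L
  ... | _ | yes i+len≤a+L =
    a , a+L≤T , refl , _ , ends∈Γ cp∈D , pred-inWindow a<i+len i+len≤a+L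
  ... | _ , _ , i'+len≤T , same | no i+len≰a+L =
    Attracted-resp {a = a} {q = i' + (a ∸ i)}
      (sym (substr-copied T {i' = i'} same i≤a a+L≤i+len))
      (resolved⇒attracted L r 1≤L source+L≤T)
    where
      a+L≤i+len : a + L ≤ i + len
      a+L≤i+len = <⇒≤ (≰⇒> i+len≰a+L)
      source+L≤T : i' + (a ∸ i) + L ≤ length T
      source+L≤T = begin
        i' + (a ∸ i) + L    ≡⟨ +-assoc i' (a ∸ i) L ⟩
        i' + ((a ∸ i) + L)  ≤⟨ +-monoʳ-≤ i' (offset-inside i≤a a+L≤i+len) ⟩
        i' + len            ≤⟨ i'+len≤T ⟩
        length T            ∎
        where open ≤-Reasoning

theorem3p6 : {A : Set} (T : List A) (D : List (Directive A)) →
    IsMacroScheme T D →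
    ∃[ Γ ] (Unique Γ × IsAttractor T Γ × (length Γ ≤ 2 * length D))
theorem3p6 T D (valid , _ , resolved) =
  Γ , deduplicate-! _≟_ ends , (Γ<length , attracts) , length-Γ≤2b
  where
    ends = map lastTargetPos D
    Γ = deduplicate _≟_ ends

    Γ<length : ∀ {p} → p ∈ Γ → p < length T
    Γ<length p∈Γ with ∈-map⁻ lastTargetPos (∈-deduplicate⁻ _≟_ ends p∈Γ)
    ... | d , d∈D , refl = lastTargetPos<length d (valid d∈D)

    attracts : ∀ a L → 1 ≤ L → a + L ≤ length T → Attracted T Γ a L
    attracts a L 1≤L a+L≤T =
      resolved⇒attracted valid (∈-deduplicate⁺ _≟_ ∘ ∈-map⁺ lastTargetPos) L
        (resolved a (<-≤-trans (m<m+n a 1≤L) a+L≤T)) 1≤L a+L≤T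

    length-Γ≤2b : length Γ ≤ 2 * length D
    length-Γ≤2b = begin
      length Γ                ≤⟨ length-deduplicate _≟_ ends ⟩
      length ends             ≡⟨ length-map lastTargetPos D ⟩
      length D                ≤⟨ m≤m+n (length D) _ ⟩
      2 * length D            ∎
      where open ≤-Reasoning
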